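{- Let $G_1$ and $G_2$ be finite simple graphs with vertex sets $V_1$ and $V_2$, where $|V_1|>1$ and $|V_2|>1$. Let $S$ be a nonempty $(G_1\vee G_2)$-admissible set, i.e. $S\neq\emptyset$ and $P(S;G_1\vee G_2)\neq\emptyset$. Then $S\subseteq V_1$ or $S\subseteq V_2$.
   Context: The join $G_1\vee G_2$ has vertex set $V_1\cup V_2$ (disjoint) and edge set $E(G_1)\cup E(G_2)\cup\{\{u,w\}: u\in V_1, w\in V_2\}$. For a graph $G$ with $N$ vertices, a labeling is a bijection $\ell:V(G)\to\{1,\ldots,N\}$; it has a peak at $v$ if $\deg_G(v)\ge2$ and $\ell(v)>\ell(w)$ for all neighbors $w$ of $v$. $P(S;G)$ is the set of labelings whose set of peaks is exactly $S$. -}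

module Defs where

open import Level using (0ℓ)
open import Data.Nat using (ℕ; _+_; _>_)
open import Data.Fin using (Fin; splitAt; _↑ˡ_; _↑ʳ_; _<_)
open import Data.Fin.Subset using (Subset; _∈_; Nonempty)
open import Data.Sum using (_⊎_; inj₁; inj₂)
open import Data.Product using (Σ; ∃; _×_; _,_)
open import Data.Unit using (⊤)
open import Data.Empty using (⊥)
open import Relation.Nullary using (¬_)
open import Relation.Binary.PropositionalEquality using (_≡_)
open import Function using (_⇔_)
open import Function.Bundles using (Bijection; _⤖_)

record Graph (n : ℕ) : Set₁ where
  field
    Adj       : Fin n → Fin n → Set
    irrefl    : ∀ v → ¬ Adj v v
    sym       : ∀ {u v} → Adj u v → Adj v u
open Graph public

-- Join G₁ ∨ G₂ on Fin (n₁ + n₂): V₁ = image of _↑ˡ n₂, V₂ = image of n₁ ↑ʳ_.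
joinAdj : ∀ {n₁ n₂} → Graph n₁ → Graph n₂ → Fin (n₁ + n₂) → Fin (n₁ + n₂) → Set
joinAdj {n₁} G₁ G₂ u v with splitAt n₁ u | splitAt n₁ v
... | inj₁ a | inj₁ b = Adj G₁ a b
... | inj₂ a | inj₂ b = Adj G₂ a b
... | inj₁ _ | inj₂ _ = ⊤
... | inj₂ _ | inj₁ _ = ⊤

joinIrrefl : ∀ {n₁ n₂} (G₁ : Graph n₁) (G₂ : Graph n₂) v → ¬ joinAdj G₁ G₂ v v
joinIrrefl {n₁} G₁ G₂ v with splitAt n₁ v
... | inj₁ a = irrefl G₁ a
... | inj₂ a = irrefl G₂ a

joinSym : ∀ {n₁ n₂} (G₁ : Graph n₁) (G₂ : Graph n₂) {u v} →
          joinAdj G₁ G₂ u v → joinAdj G₁ G₂ v u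
joinSym {n₁} G₁ G₂ {u} {v} p with splitAt n₁ u | splitAt n₁ v
... | inj₁ a | inj₁ b = sym G₁ p
... | inj₂ a | inj₂ b = sym G₂ p
... | inj₁ _ | inj₂ _ = _
... | inj₂ _ | inj₁ _ = _

_∨G_ : ∀ {n₁ n₂} → Graph n₁ → Graph n₂ → Graph (n₁ + n₂)
G₁ ∨G G₂ = record
  { Adj = joinAdj G₁ G₂ ; irrefl = joinIrrefl G₁ G₂ ; sym = joinSym G₁ G₂ }

DegAtLeast2 : ∀ {n} → Graph n → Fin n → Set
DegAtLeast2 G v = Σ _ λ w₁ → Σ _ λ w₂ → ¬ (w₁ ≡ w₂) × Adj G v w₁ × Adj G v w₂

-- A labeling: a bijection V → {1,…,N}; we use Fin N = {0,…,N-1}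
-- (shifting labels by one does not change comparisons).
Labeling : ℕ → Set
Labeling n = Fin n ⤖ Fin n

open Bijection using (to)

IsPeak : ∀ {n} → Graph n → Labeling n → Fin n → Set
IsPeak G ℓ v = DegAtLeast2 G v × (∀ w → Adj G v w → to ℓ w < to ℓ v)

InP : ∀ {n} → Subset n → Graph n → Labeling n → Set
InP S G ℓ = ∀ v → (IsPeak G ℓ v ⇔ v ∈ S)

Admissible : ∀ {n} → Graph n → Subset n → Set
Admissible G S = ∃ λ ℓ → InP S G ℓ

⊆V₁ : ∀ {n₁ n₂} → Subset (n₁ + n₂) → Set
⊆V₁ {n₁} {n₂} S = ∀ v → v ∈ S → ∃ λ (a : Fin n₁) → v ≡ a ↑ˡ n₂

⊆V₂ : ∀ {n₁ n₂} → Subset (n₁ + n₂) → Set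
⊆V₂ {n₁} {n₂} S = ∀ v → v ∈ S → ∃ λ (b : Fin n₂) → v ≡ n₁ ↑ʳ b

module Submission where

-- Two peaks of a labeling are never adjacent: each would have
-- to carry a larger label than the other.  Hence the peak set S of any
-- labeling is an independent set.  In the join G₁ ∨ G₂ every vertex of V₁
-- is adjacent to every vertex of V₂, so an independent set cannot meet
-- both sides and therefore lies inside V₁ or inside V₂.

open import Defs
open import Data.Nat using (ℕ; _+_; _>_)
open import Data.Fin using (Fin; splitAt; _↑ˡ_; _↑ʳ_)
open import Data.Fin.Properties
  using (<-asym; any?; splitAt-↑ˡ; splitAt-↑ʳ; splitAt⁻¹-↑ˡ; splitAt⁻¹-↑ʳ)
open import Data.Fin.Subset using (Subset; Nonempty; _∈_)
open import Data.Fin.Subset.Properties using (_∈?_)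
open import Data.Sum using (_⊎_; inj₁; inj₂)
open import Data.Product using (∃; _,_)
open import Data.Unit using (tt)
open import Data.Empty using (⊥-elim)
open import Relation.Nullary using (¬_; yes; no)
open import Relation.Binary.PropositionalEquality using (_≡_; refl) renaming (sym to ≡-sym)
open import Function.Bundles using (Equivalence)

Independent : ∀ {n} → Graph n → Subset n → Set
Independent G S = ∀ u v → u ∈ S → v ∈ S → ¬ Adj G u v

-- Two adjacent vertices cannot both be peaks, since each peak carries a
-- strictly larger label than all of its neighbours.
peaks-nonadjacent : ∀ {n} (G : Graph n) (ℓ : Labeling n) {u v : Fin n} →
                    IsPeak G ℓ u → IsPeak G ℓ v → ¬ Adj G u v
peaks-nonadjacent G ℓ {u} {v} (_ , u-highest) (_ , v-highest) u~v =
  <-asym (u-highest v u~v) (v-highest u (Graph.sym G u~v))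

admissible⇒independent : ∀ {n} (G : Graph n) (S : Subset n) →
                         Admissible G S → Independent G S
admissible⇒independent G S (ℓ , peaks≡S) u v u∈S v∈S =
  peaks-nonadjacent G ℓ (peak u u∈S) (peak v v∈S)
  where
  peak : ∀ w → w ∈ S → IsPeak G ℓ w
  peak w = Equivalence.from (peaks≡S w)

module _ {n₁ n₂ : ℕ} where

  -- Membership of a vertex of the join in V₁, resp. V₂; note that
  -- ⊆V₁ S and ⊆V₂ S unfold to  ∀ v → v ∈ S → InV₁ v  (resp. InV₂ v).
  InV₁ : Fin (n₁ + n₂) → Set
  InV₁ v = ∃ λ (a : Fin n₁) → v ≡ a ↑ˡ n₂

  InV₂ : Fin (n₁ + n₂) → Set
  InV₂ v = ∃ λ (b : Fin n₂) → v ≡ n₁ ↑ʳ b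

  side : ∀ v → InV₁ v ⊎ InV₂ v
  side v with splitAt n₁ v in eq
  ... | inj₁ a = inj₁ (a , ≡-sym (splitAt⁻¹-↑ˡ eq))
  ... | inj₂ b = inj₂ (b , ≡-sym (splitAt⁻¹-↑ʳ eq))

  module _ (G₁ : Graph n₁) (G₂ : Graph n₂) where

    cross-adjacent : ∀ {u v} → InV₁ u → InV₂ v → Adj (G₁ ∨G G₂) u v
    cross-adjacent (a , refl) (b , refl)
      rewrite splitAt-↑ˡ n₁ a n₂ | splitAt-↑ʳ n₁ n₂ b = tt

    -- An independent set of the join lies entirely in V₁ or entirely in V₂:
    -- if it contains some vertex of V₂, no vertex of V₁ can join it.
    independent-in-join : ∀ S → Independent (G₁ ∨G G₂) S →
                          ⊆V₁ {n₁} {n₂} S ⊎ ⊆V₂ {n₁} {n₂} S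
    independent-in-join S indep with any? (λ b → (n₁ ↑ʳ b) ∈? S)
    ... | yes (b , b∈S) = inj₂ inside-V₂
      where
      inside-V₂ : ⊆V₂ {n₁} {n₂} S
      inside-V₂ w w∈S with side w
      ... | inj₂ w∈V₂ = w∈V₂
      ... | inj₁ w∈V₁ =
        ⊥-elim (indep w (n₁ ↑ʳ b) w∈S b∈S (cross-adjacent w∈V₁ (b , refl)))
    ... | no no-V₂-member = inj₁ inside-V₁
      where
      inside-V₁ : ⊆V₁ {n₁} {n₂} S
      inside-V₁ w w∈S with side w
      ... | inj₁ w∈V₁ = w∈V₁
      ... | inj₂ (c , refl) = ⊥-elim (no-V₂-member (c , w∈S))

proposition3p1 : ∀ {n₁ n₂ : ℕ} (G₁ : Graph n₁) (G₂ : Graph n₂) →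
    n₁ > 1 → n₂ > 1 → (S : Subset (n₁ + n₂)) →
    Nonempty S → Admissible (G₁ ∨G G₂) S →
    ⊆V₁ {n₁} {n₂} S ⊎ ⊆V₂ {n₁} {n₂} S
proposition3p1 G₁ G₂ _ _ S _ admissible =
  independent-in-join G₁ G₂ S (admissible⇒independent (G₁ ∨G G₂) S admissible)
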